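{- Let $m\ge 2$. The number $N_m$ of unordered partitions of $F_2^m$ into $2$-dimensional affine subspaces satisfies $N_m\ge T_{m-2}$, where $T_{m-2}$ is the number of transversals in the latin hypercube $Q_{m-2}$.
   Context: $F_2^m$ is the $m$-dimensional vector space over $F_2=\{0,1\}$ with addition $\oplus$; a $2$-dimensional affine subspace is a $4$-element set $\{x_1,\dots,x_4\}$ with $x_1\oplus x_2\oplus x_3\oplus x_4=\overline{0}$. For $r\ge 0$, $Q_r$ is the $3$-dimensional latin hypercube of order $2^r$ given by the Cayley table of the iterated group $\mathbb{Z}_2^r$: its entries are identified with the tuples $(\alpha_1,\alpha_2,\alpha_3,\alpha_4)\in (F_2^r)^4$ with $\alpha_1\oplus\alpha_2\oplus\alpha_3\oplus\alpha_4=\overline{0}$ (the first three coordinates being the index and the fourth the symbol). A transversal in $Q_r$ is a collection of $2^r$ such tuples $(\alpha_1^i,\dots,\alpha_4^i)$, $i=1,\dots,2^r$, such that for each $j\in\{1,2,3,4\}$ the elements $\alpha_j^1,\dots,\alpha_j^{2^r}$ are pairwise distinct. -}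

module Defs where

open import Data.Bool using (Bool; true; false; _∧_; not; _xor_; if_then_else_)
open import Data.Bool.Properties using () renaming (_≟_ to _≟B_)
open import Data.Nat using (ℕ; zero; suc; _+_; _^_; _≡ᵇ_)
open import Data.Fin using (Fin)
open import Data.List using (List; []; _∷_; [_]; _++_; map; concatMap; length; filterᵇ; foldr)
open import Data.Bool.ListAction using (all; any)
open import Data.Vec using (Vec; zipWith; replicate; lookup) renaming ([] to []ᵥ; _∷_ to _∷ᵥ_)
open import Data.Vec.Properties using (≡-dec)
open import Relation.Nullary.Decidable using (⌊_⌋)

F₂^ : ℕ → Set
F₂^ m = Vec Bool m

_⊕_ : ∀ {m} → F₂^ m → F₂^ m → F₂^ m
_⊕_ = zipWith _xor_

0̄ : ∀ {m} → F₂^ m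
0̄ = replicate _ false

_==_ : ∀ {m} → F₂^ m → F₂^ m → Bool
x == y = ⌊ ≡-dec _≟B_ x y ⌋

allF : ∀ m → List (F₂^ m)
allF zero    = [ []ᵥ ]
allF (suc m) = map (false ∷ᵥ_) (allF m) ++ map (true ∷ᵥ_) (allF m)

-- All sublists of a list (2^n of them). For a duplicate-free list these
-- are in bijection with the subsets of its underlying set.
sublists : ∀ {a} {A : Set a} → List A → List (List A)
sublists []       = [ [] ]
sublists (x ∷ xs) = sublists xs ++ map (x ∷_) (sublists xs)

countᵇ : ∀ {a} {A : Set a} → (A → Bool) → List A → ℕ
countᵇ p xs = length (filterᵇ p xs)

_∈ᵇ_ : ∀ {m} → F₂^ m → List (F₂^ m) → Bool
x ∈ᵇ xs = any (x ==_) xs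

pairwiseDistinct : ∀ {m} → List (F₂^ m) → Bool
pairwiseDistinct []       = true
pairwiseDistinct (x ∷ xs) = not (x ∈ᵇ xs) ∧ pairwiseDistinct xs

-- A subset of F₂^m is a sublist of allF m.  It is a 2-dimensional affine
-- subspace iff it has 4 elements x₁,…,x₄ with x₁ ⊕ x₂ ⊕ x₃ ⊕ x₄ = 0̄.
isPlane : ∀ {m} → List (F₂^ m) → Bool
isPlane b = (length b ≡ᵇ 4) ∧ (foldr _⊕_ 0̄ b == 0̄)

-- An unordered partition of F₂^m into 2-dim affine subspaces: a set of
-- subsets (a sublist of sublists (allF m)) all of which are planes and
-- such that every point lies in exactly one of them.
isPlanePartition : ∀ m → List (List (F₂^ m)) → Bool
isPlanePartition m P =
  all isPlane P ∧ all (λ v → countᵇ (v ∈ᵇ_) P ≡ᵇ 1) (allF m)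

N : ℕ → ℕ
N m = countᵇ (isPlanePartition m) (sublists (sublists (allF m)))

Entry : ℕ → Set
Entry r = Vec (F₂^ r) 4

-- All entries of Q_r, each exactly once: index (α₁,α₂,α₃) and symbol
-- α₄ = α₁ ⊕ α₂ ⊕ α₃.
entries : ∀ r → List (Entry r)
entries r =
  concatMap (λ a₁ → concatMap (λ a₂ → map (λ a₃ →
      a₁ ∷ᵥ a₂ ∷ᵥ a₃ ∷ᵥ ((a₁ ⊕ a₂) ⊕ a₃) ∷ᵥ []ᵥ)
    (allF r)) (allF r)) (allF r)

isTransversal : ∀ r → List (Entry r) → Bool
isTransversal r S =
  (length S ≡ᵇ 2 ^ r) ∧ all (λ (j : Fin 4) → pairwiseDistinct (map (λ e → lookup e j) S)) allFin4
  where
  allFin4 : List (Fin 4)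
  allFin4 = Fin.zero ∷ Fin.suc Fin.zero ∷ Fin.suc (Fin.suc Fin.zero) ∷ Fin.suc (Fin.suc (Fin.suc Fin.zero)) ∷ []

T : ℕ → ℕ
T r = countᵇ (isTransversal r) (sublists (entries r))

module Submission where

-- An entry (α₁, α₂, α₃, α₄) of Q_r gives the set {00α₁, 01α₂, 10α₃, 11α₄} in F₂^(r+2), a
-- 2-dimensional affine subspace because α₁ ⊕ α₂ ⊕ α₃ ⊕ α₄ = 0̄.  In a transversal each
-- coordinate αⱼ takes every value of F₂^r exactly once, so the 2^r planes of its entries meet
-- the j-th quadrant {b₁b₂x : x ∈ F₂^r} in every point exactly once: they partition F₂^(r+2).
-- An entry is read off from its plane, so distinct transversals give distinct partitions.

open import Defs
open import Data.Bool using (Bool; true; false; not) renaming (T to True)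
open import Data.Bool.Properties using (T-∧; xor-assoc; xor-same; xor-identityʳ) renaming (_≟_ to _≟B_)
open import Data.Nat using (ℕ; zero; suc; _≤_; _∸_; _^_; _+_; _≡ᵇ_; s≤s; z≤n)
open import Data.Nat.Properties using (≤-antisym; ≤⇒≯; ≤-reflexive; ≡ᵇ⇒≡; ≡⇒≡ᵇ; +-identityʳ)
open import Data.Fin using (Fin) renaming (zero to 0F; suc to sucF)
open import Data.List using (List; []; _∷_; [_]; _++_; map; concatMap; length; filter; filterᵇ; allFin)
open import Data.List.Properties as List using (length-++-sucʳ; length-map)
open import Data.Vec using (lookup) renaming ([] to []ᵥ; _∷_ to _∷ᵥ_)
import Data.Vec.Properties as Vec
open import Data.List.Membership.Propositional using (_∈_)
open import Data.List.Membership.Propositional.Properties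
  using (∈-∃++; ∈-++⁺ˡ; ∈-++⁺ʳ; ∈-++⁻; ∈-map⁺; ∈-map⁻; ∈-filter⁺; ∈-filter⁻; ∈-concatMap⁻; ∈-allFin)
import Data.List.Membership.DecPropositional as DecMembership
open import Data.List.Relation.Unary.Any using (here; there; satisfied)
import Data.List.Relation.Unary.Any as Any
open import Data.List.Relation.Unary.Any.Properties using (any⁺; any⁻)
open import Data.List.Relation.Unary.All using ([]; _∷_)
import Data.List.Relation.Unary.All as All
open import Data.List.Relation.Unary.All.Properties
  using (all⁺; all⁻; ¬Any⇒All¬) renaming (map⁺ to All-map⁺)
import Data.List.Relation.Unary.AllPairs as AllPairs
import Data.List.Relation.Unary.AllPairs.Properties as AllPairs
open import Data.List.Relation.Unary.Unique.Propositional using (Unique; []; _∷_)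
import Data.List.Relation.Unary.Unique.Propositional.Properties as Unique
open import Data.List.Relation.Binary.Sublist.Propositional using ([]; _∷_; _∷ʳ_; from∈)
  renaming (_⊆_ to _⊑_; lookup to ⊑-lookup)
open import Data.List.Relation.Binary.Sublist.Propositional.Properties using (filter-⊆; ++⁺)
  renaming (map⁺ to ⊑-map⁺)
open import Data.Product using (∃; ∃₂; _×_; _,_; proj₁; proj₂)
open import Data.Sum using (inj₁; inj₂)
open import Data.Empty using (⊥-elim)
open import Function using (id; _∘_; _⇔_; mk⇔; Equivalence)
open import Relation.Nullary using (¬_; Dec; yes; no)
open import Relation.Nullary.Decidable using (toWitness; fromWitness)
open import Relation.Binary.Definitions using (DecidableEquality)
open import Relation.Binary.PropositionalEquality
  using (_≡_; _≢_; refl; sym; trans; cong; cong₂; subst; module ≡-Reasoning)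

private
  variable
    A B : Set

-- Counting duplicate-free lists

∈-++-∷⁻ : ∀ (ys : List A) {v w zs} → v ∈ ys ++ w ∷ zs → v ≢ w → v ∈ ys ++ zs
∈-++-∷⁻ []       (here v≡w) v≢w = ⊥-elim (v≢w v≡w)
∈-++-∷⁻ []       (there v∈) _   = v∈
∈-++-∷⁻ (y ∷ ys) (here v≡y) _   = here v≡y
∈-++-∷⁻ (y ∷ ys) (there v∈) v≢w = there (∈-++-∷⁻ ys v∈ v≢w)

injection⇒length≤ : (g : A → B) (xs : List A) (ys : List B) → Unique xs →
                    (∀ {x} → x ∈ xs → g x ∈ ys) →
                    (∀ {x x′} → x ∈ xs → x′ ∈ xs → g x ≡ g x′ → x ≡ x′) →
                    length xs ≤ length ys
injection⇒length≤ g []       ys _          _    _   = z≤n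
injection⇒length≤ g (x ∷ xs) ys (x∉ ∷ xs!) into inj with ∈-∃++ (into (here refl))
... | ys₁ , ys₂ , refl = subst (suc (length xs) ≤_) (sym (length-++-sucʳ ys₁ _ ys₂))
  (s≤s (injection⇒length≤ g xs (ys₁ ++ ys₂) xs!
    (λ x′∈ → ∈-++-∷⁻ ys₁ (into (there x′∈))
               (λ gx′≡gx → All.lookup x∉ x′∈ (sym (inj (there x′∈) (here refl) gx′≡gx))))
    (λ x′∈ x″∈ → inj (there x′∈) (there x″∈))))

∈⇒length≥1 : ∀ {x : A} {xs} → x ∈ xs → 1 ≤ length xs
∈⇒length≥1 (here _)  = s≤s z≤n
∈⇒length≥1 (there _) = s≤s z≤n

countᵇ≡1 : (p : A → Bool) {xs : List A} {x : A} → Unique xs → x ∈ xs → True (p x) →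
           (∀ {y} → y ∈ xs → True (p y) → y ≡ x) → countᵇ p xs ≡ 1
countᵇ≡1 p {xs} {x} xs! x∈ px unique = ≤-antisym
  (injection⇒length≤ id (filterᵇ p xs) [ x ] (Unique.filter⁺ _ xs!)
    (λ y∈ → let y∈xs , py = ∈-filter⁻ _ {xs = xs} y∈ in here (unique y∈xs py))
    (λ _ _ → id))
  (∈⇒length≥1 (∈-filter⁺ _ x∈ px))

-- If x were missing, x ∷ xs would inject into the covering list ys.
complete-if-long : DecidableEquality A → {xs ys : List A} → (∀ y → y ∈ ys) →
                   Unique xs → length ys ≤ length xs → ∀ x → x ∈ xs
complete-if-long _≟_ {xs} {ys} covers xs! long x with DecMembership._∈?_ _≟_ x xs
... | yes x∈ = x∈
... | no x∉ = ⊥-elim (≤⇒≯ long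
  (injection⇒length≤ id (x ∷ xs) ys (¬Any⇒All¬ xs x∉ ∷ xs!) (λ {y} _ → covers y) (λ _ _ → id)))

Unique-map⇒injective : (f : A → B) {xs : List A} → Unique (map f xs) →
                       ∀ {x y} → x ∈ xs → y ∈ xs → f x ≡ f y → x ≡ y
Unique-map⇒injective f _          (here refl) (here refl) _   = refl
Unique-map⇒injective f (fx∉ ∷ _)  (here refl) (there y∈)  fx≡fy =
  ⊥-elim (All.lookup fx∉ (∈-map⁺ f y∈) fx≡fy)
Unique-map⇒injective f (fy∉ ∷ _)  (there x∈)  (here refl) fx≡fy =
  ⊥-elim (All.lookup fy∉ (∈-map⁺ f x∈) (sym fx≡fy))
Unique-map⇒injective f (_ ∷ fxs!) (there x∈)  (there y∈)  fx≡fy =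
  Unique-map⇒injective f fxs! x∈ y∈ fx≡fy

concatMap-Unique : (f : A → List B) (key : B → A) → (∀ {a y} → y ∈ f a → key y ≡ a) →
                   (∀ a → Unique (f a)) → {xs : List A} → Unique xs → Unique (concatMap f xs)
concatMap-Unique f key key-f f! xs! = Unique.concat⁺
  (All-map⁺ (All.tabulate (λ {a} _ → f! a)))
  (AllPairs.map⁺ {f = f} (AllPairs.map disjoint xs!))
  where
  disjoint : ∀ {a b} → a ≢ b → ∀ {y} → ¬ (y ∈ f a × y ∈ f b)
  disjoint a≢b (y∈fa , y∈fb) = a≢b (trans (sym (key-f y∈fa)) (key-f y∈fb))

∈-sublists⁺ : ∀ {xs ys : List A} → xs ⊑ ys → xs ∈ sublists ys
∈-sublists⁺ []                      = here refl
∈-sublists⁺ {ys = y ∷ ys} (y ∷ʳ xs⊑) = ∈-++⁺ˡ (∈-sublists⁺ xs⊑)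
∈-sublists⁺ {ys = y ∷ ys} (refl ∷ xs⊑) = ∈-++⁺ʳ (sublists ys) (∈-map⁺ (y ∷_) (∈-sublists⁺ xs⊑))

∈-sublists⁻ : ∀ {xs : List A} ys → xs ∈ sublists ys → xs ⊑ ys
∈-sublists⁻ []       (here refl) = []
∈-sublists⁻ (y ∷ ys) xs∈ with ∈-++⁻ (sublists ys) xs∈
... | inj₁ xs∈′ = y ∷ʳ ∈-sublists⁻ ys xs∈′
... | inj₂ y∷xs∈ with ∈-map⁻ (y ∷_) y∷xs∈
... | _ , xs∈′ , refl = refl ∷ ∈-sublists⁻ ys xs∈′

sublists-Unique : ∀ {ys : List A} → Unique ys → Unique (sublists ys)
sublists-Unique []             = [] ∷ []
sublists-Unique {ys = y ∷ ys} (y∉ ∷ ys!) =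
  Unique.++⁺ (sublists-Unique ys!) (Unique.map⁺ ∷-injective (sublists-Unique ys!)) disjoint
  where
  ∷-injective : ∀ {xs xs′ : List _} → y ∷ xs ≡ y ∷ xs′ → xs ≡ xs′
  ∷-injective refl = refl
  disjoint : ∀ {xs} → ¬ (xs ∈ sublists ys × xs ∈ map (y ∷_) (sublists ys))
  disjoint (xs∈ , y∷xs∈) with ∈-map⁻ (y ∷_) y∷xs∈
  ... | _ , _ , refl = All.lookup y∉ (⊑-lookup (∈-sublists⁻ ys xs∈) (here refl)) refl

⊑-Unique-ext : ∀ {xs xs′ ys : List A} → Unique ys → xs ⊑ ys → xs′ ⊑ ys →
               (∀ {x} → x ∈ xs → x ∈ xs′) → (∀ {x} → x ∈ xs′ → x ∈ xs) → xs ≡ xs′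
⊑-Unique-ext [] [] [] _ _ = refl
⊑-Unique-ext (y∉ ∷ ys!) (y ∷ʳ xs⊑) (.y ∷ʳ xs′⊑) ⊆ ⊇ = ⊑-Unique-ext ys! xs⊑ xs′⊑ ⊆ ⊇
⊑-Unique-ext (y∉ ∷ ys!) (y ∷ʳ xs⊑) (refl ∷ xs′⊑) ⊆ ⊇ =
  ⊥-elim (All.lookup y∉ (⊑-lookup xs⊑ (⊇ (here refl))) refl)
⊑-Unique-ext (y∉ ∷ ys!) (refl ∷ xs⊑) (y ∷ʳ xs′⊑) ⊆ ⊇ =
  ⊥-elim (All.lookup y∉ (⊑-lookup xs′⊑ (⊆ (here refl))) refl)
⊑-Unique-ext {ys = y ∷ ys} (y∉ ∷ ys!) (refl ∷ xs⊑) (refl ∷ xs′⊑) ⊆ ⊇ =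
  cong (y ∷_) (⊑-Unique-ext ys! xs⊑ xs′⊑ (λ x∈ → tail xs⊑ x∈ (⊆ (there x∈)))
                                        (λ x∈ → tail xs′⊑ x∈ (⊇ (there x∈))))
  where
  tail : ∀ {x zs zs′} → zs ⊑ ys → x ∈ zs → x ∈ y ∷ zs′ → x ∈ zs′
  tail zs⊑ x∈ (here refl) = ⊥-elim (All.lookup y∉ (⊑-lookup zs⊑ x∈) refl)
  tail _   _  (there x∈′) = x∈′

_≟_ : ∀ {m} → DecidableEquality (F₂^ m)
_≟_ = Vec.≡-dec _≟B_

∈ᵇ⇔∈ : ∀ {m} {x : F₂^ m} {xs} → True (x ∈ᵇ xs) ⇔ x ∈ xs
∈ᵇ⇔∈ {x = x} {xs} = mk⇔ (Any.map toWitness ∘ any⁻ (x ==_) xs) (any⁺ (x ==_) ∘ Any.map fromWitness)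

pairwiseDistinct⇒Unique : ∀ {m} (xs : List (F₂^ m)) → True (pairwiseDistinct xs) → Unique xs
pairwiseDistinct⇒Unique []       _ = []
pairwiseDistinct⇒Unique (x ∷ xs) t with Equivalence.to T-∧ t
... | x∉ , xs! = ¬Any⇒All¬ xs (not-true x∉ ∘ Equivalence.from ∈ᵇ⇔∈) ∷ pairwiseDistinct⇒Unique xs xs!
  where
  not-true : ∀ {b} → True (not b) → ¬ True b
  not-true {false} _ ()

⊕-assoc : ∀ {m} (x y z : F₂^ m) → (x ⊕ y) ⊕ z ≡ x ⊕ (y ⊕ z)
⊕-assoc = Vec.zipWith-assoc xor-assoc

⊕-identityʳ : ∀ {m} (x : F₂^ m) → x ⊕ 0̄ ≡ x
⊕-identityʳ = Vec.zipWith-identityʳ xor-identityʳ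

⊕-self : ∀ {m} (x : F₂^ m) → x ⊕ x ≡ 0̄
⊕-self []ᵥ       = refl
⊕-self (b ∷ᵥ x) = cong₂ _∷ᵥ_ (xor-same b) (⊕-self x)

allF-complete : ∀ {m} (x : F₂^ m) → x ∈ allF m
allF-complete []ᵥ                  = here refl
allF-complete         (false ∷ᵥ x) = ∈-++⁺ˡ (∈-map⁺ (false ∷ᵥ_) (allF-complete x))
allF-complete {suc m} (true  ∷ᵥ x) =
  ∈-++⁺ʳ (map (false ∷ᵥ_) (allF m)) (∈-map⁺ (true ∷ᵥ_) (allF-complete x))

allF-Unique : ∀ m → Unique (allF m)
allF-Unique zero    = [] ∷ []
allF-Unique (suc m) =
  Unique.++⁺ (Unique.map⁺ ∷-injectiveʳ (allF-Unique m)) (Unique.map⁺ ∷-injectiveʳ (allF-Unique m)) disjoint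
  where
  ∷-injectiveʳ : ∀ {b} {x y : F₂^ m} → b ∷ᵥ x ≡ b ∷ᵥ y → x ≡ y
  ∷-injectiveʳ refl = refl
  disjoint : ∀ {x} → ¬ (x ∈ map (false ∷ᵥ_) (allF m) × x ∈ map (true ∷ᵥ_) (allF m))
  disjoint (x∈₀ , x∈₁) with ∈-map⁻ (false ∷ᵥ_) x∈₀ | ∈-map⁻ (true ∷ᵥ_) x∈₁
  ... | _ , _ , refl | _ , _ , ()

allF-length : ∀ m → length (allF m) ≡ 2 ^ m
allF-length zero    = refl
allF-length (suc m) = begin
  length (map (false ∷ᵥ_) (allF m) ++ map (true ∷ᵥ_) (allF m))
    ≡⟨ List.length-++ (map (false ∷ᵥ_) (allF m)) ⟩
  length (map (false ∷ᵥ_) (allF m)) + length (map (true ∷ᵥ_) (allF m))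
    ≡⟨ cong₂ _+_ (length-map _ (allF m)) (length-map _ (allF m)) ⟩
  length (allF m) + length (allF m)
    ≡⟨ cong (λ n → n + n) (allF-length m) ⟩
  2 ^ m + 2 ^ m
    ≡⟨ cong (2 ^ m +_) (sym (+-identityʳ (2 ^ m))) ⟩
  2 ^ suc m ∎
  where open ≡-Reasoning

Unique∧length≡2^⇒∈ : ∀ {m} {xs : List (F₂^ m)} → Unique xs → length xs ≡ 2 ^ m → ∀ x → x ∈ xs
Unique∧length≡2^⇒∈ {m} xs! ∣xs∣≡2^m =
  complete-if-long _≟_ allF-complete xs! (≤-reflexive (trans (allF-length m) (sym ∣xs∣≡2^m)))

-- The latin hypercube Q_r and its transversals

entry : ∀ {r} → F₂^ r → F₂^ r → F₂^ r → Entry r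
entry a₁ a₂ a₃ = a₁ ∷ᵥ a₂ ∷ᵥ a₃ ∷ᵥ ((a₁ ⊕ a₂) ⊕ a₃) ∷ᵥ []ᵥ

entry-sum : ∀ {r} (a₁ a₂ a₃ : F₂^ r) → a₁ ⊕ (a₂ ⊕ (a₃ ⊕ (((a₁ ⊕ a₂) ⊕ a₃) ⊕ 0̄))) ≡ 0̄
entry-sum a₁ a₂ a₃ = begin
  a₁ ⊕ (a₂ ⊕ (a₃ ⊕ (a₄ ⊕ 0̄))) ≡⟨ cong (λ z → a₁ ⊕ (a₂ ⊕ (a₃ ⊕ z))) (⊕-identityʳ a₄) ⟩
  a₁ ⊕ (a₂ ⊕ (a₃ ⊕ a₄))        ≡⟨ sym (⊕-assoc a₁ a₂ (a₃ ⊕ a₄)) ⟩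
  (a₁ ⊕ a₂) ⊕ (a₃ ⊕ a₄)        ≡⟨ sym (⊕-assoc (a₁ ⊕ a₂) a₃ a₄) ⟩
  a₄ ⊕ a₄                       ≡⟨ ⊕-self a₄ ⟩
  0̄                             ∎
  where
  open ≡-Reasoning
  a₄ = (a₁ ⊕ a₂) ⊕ a₃

∈-entries⁻ : ∀ {r} {e : Entry r} → e ∈ entries r → ∃₂ λ a₁ a₂ → ∃ λ a₃ → e ≡ entry a₁ a₂ a₃
∈-entries⁻ {r} e∈ with satisfied (∈-concatMap⁻ _ {xs = allF r} e∈)
... | a₁ , e∈₁ with satisfied (∈-concatMap⁻ _ {xs = allF r} e∈₁)
... | a₂ , e∈₂ with ∈-map⁻ (entry a₁ a₂) e∈₂
... | a₃ , _ , e≡ = a₁ , a₂ , a₃ , e≡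

entries-Unique : ∀ r → Unique (entries r)
entries-Unique r =
  concatMap-Unique (λ a₁ → concatMap (row a₁) (allF r)) (λ e → lookup e 0F) first-coordinate
  (λ a₁ → concatMap-Unique (row a₁) (λ e → lookup e (sucF 0F)) second-coordinate
    (λ a₁ → Unique.map⁺ third-coordinate (allF-Unique r)) (allF-Unique r))
  (allF-Unique r)
  where
  row : F₂^ r → F₂^ r → List (Entry r)
  row a₁ a₂ = map (entry a₁ a₂) (allF r)
  third-coordinate : ∀ {a₁ a₂ a₃ a₃′} → entry a₁ a₂ a₃ ≡ entry a₁ a₂ a₃′ → a₃ ≡ a₃′
  third-coordinate refl = refl
  second-coordinate : ∀ {a₁ a₂ e} → e ∈ row a₁ a₂ → lookup e (sucF 0F) ≡ a₂
  second-coordinate {a₁} {a₂} e∈ with ∈-map⁻ (entry a₁ a₂) e∈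
  ... | _ , _ , refl = refl
  first-coordinate : ∀ {a₁ e} → e ∈ concatMap (row a₁) (allF r) → lookup e 0F ≡ a₁
  first-coordinate {a₁} e∈ with satisfied (∈-concatMap⁻ _ {xs = allF r} e∈)
  ... | a₂ , e∈′ with ∈-map⁻ (entry a₁ a₂) e∈′
  ... | _ , _ , refl = refl

column : ∀ {r} → Fin 4 → List (Entry r) → List (F₂^ r)
column j = map (λ e → lookup e j)

isTransversal⇒length : ∀ {r} (S : List (Entry r)) → True (isTransversal r S) → length S ≡ 2 ^ r
isTransversal⇒length {r} S t = ≡ᵇ⇒≡ (length S) (2 ^ r) (proj₁ (Equivalence.to T-∧ t))

isTransversal⇒column-Unique : ∀ {r} (S : List (Entry r)) → True (isTransversal r S) →
                              ∀ j → Unique (column j S)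
isTransversal⇒column-Unique {r} S t j = pairwiseDistinct⇒Unique (column j S)
  (All.lookup (all⁺ (λ j → pairwiseDistinct (column j S)) (allFin 4) columns-distinct) (∈-allFin j))
  where
  columns-distinct = proj₂ (Equivalence.to (T-∧ {length S ≡ᵇ 2 ^ r}) t)

isTransversal⇒column-complete : ∀ {r} (S : List (Entry r)) → True (isTransversal r S) →
                                ∀ j x → x ∈ column j S
isTransversal⇒column-complete S t j = Unique∧length≡2^⇒∈ (isTransversal⇒column-Unique S t j)
  (trans (length-map _ S) (isTransversal⇒length S t))

-- F₂^(2+r) ≅ Fin 4 × F₂^r: the first two bits of a point select one of four quadrants.
embed : ∀ {r} → Fin 4 → F₂^ r → F₂^ (2 + r)
embed 0F                      x = false ∷ᵥ false ∷ᵥ x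
embed (sucF 0F)               x = false ∷ᵥ true  ∷ᵥ x
embed (sucF (sucF 0F))        x = true  ∷ᵥ false ∷ᵥ x
embed (sucF (sucF (sucF 0F))) x = true  ∷ᵥ true  ∷ᵥ x

split : ∀ {r} → F₂^ (2 + r) → Fin 4 × F₂^ r
split (false ∷ᵥ false ∷ᵥ x) = 0F , x
split (false ∷ᵥ true  ∷ᵥ x) = sucF 0F , x
split (true  ∷ᵥ false ∷ᵥ x) = sucF (sucF 0F) , x
split (true  ∷ᵥ true  ∷ᵥ x) = sucF (sucF (sucF 0F)) , x

split-embed : ∀ {r} j (x : F₂^ r) → split (embed j x) ≡ (j , x)
split-embed 0F                      x = refl
split-embed (sucF 0F)               x = refl
split-embed (sucF (sucF 0F))        x = refl
split-embed (sucF (sucF (sucF 0F))) x = refl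

embed-split : ∀ {r} (v : F₂^ (2 + r)) → embed (proj₁ (split v)) (proj₂ (split v)) ≡ v
embed-split (false ∷ᵥ false ∷ᵥ x) = refl
embed-split (false ∷ᵥ true  ∷ᵥ x) = refl
embed-split (true  ∷ᵥ false ∷ᵥ x) = refl
embed-split (true  ∷ᵥ true  ∷ᵥ x) = refl

embed-injective : ∀ {r} {j j′} {x x′ : F₂^ r} → embed j x ≡ embed j′ x′ → (j , x) ≡ (j′ , x′)
embed-injective {j = j} {j′} {x} {x′} eq =
  trans (sym (split-embed j x)) (trans (cong split eq) (split-embed j′ x′))

plane : ∀ {r} → Entry r → List (F₂^ (2 + r))
plane e = map (λ j → embed j (lookup e j)) (allFin 4)

embed∈plane⁺ : ∀ {r} (e : Entry r) j → embed j (lookup e j) ∈ plane e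
embed∈plane⁺ e j = ∈-map⁺ (λ j → embed j (lookup e j)) (∈-allFin j)

embed∈plane⁻ : ∀ {r} (e : Entry r) {j x} → embed j x ∈ plane e → lookup e j ≡ x
embed∈plane⁻ e v∈ with ∈-map⁻ (λ j → embed j (lookup e j)) {xs = allFin 4} v∈
... | j′ , _ , v≡ with embed-injective {j′ = j′} {x′ = lookup e j′} v≡
... | refl = refl

plane-injective : ∀ {r} {e e′ : Entry r} → plane e ≡ plane e′ → e ≡ e′
plane-injective {e = _ ∷ᵥ _ ∷ᵥ _ ∷ᵥ _ ∷ᵥ []ᵥ} {_ ∷ᵥ _ ∷ᵥ _ ∷ᵥ _ ∷ᵥ []ᵥ} refl = refl

plane⊑allF : ∀ {r} (e : Entry r) → plane e ⊑ allF (2 + r)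
plane⊑allF (a₁ ∷ᵥ a₂ ∷ᵥ a₃ ∷ᵥ a₄ ∷ᵥ []ᵥ) =
  ++⁺ (⊑-map⁺ (false ∷ᵥ_) (pair a₁ a₂)) (⊑-map⁺ (true ∷ᵥ_) (pair a₃ a₄))
  where
  pair : ∀ a b → (false ∷ᵥ a) ∷ (true ∷ᵥ b) ∷ [] ⊑ allF (suc _)
  pair a b =
    ++⁺ (⊑-map⁺ (false ∷ᵥ_) (from∈ (allF-complete a))) (⊑-map⁺ (true ∷ᵥ_) (from∈ (allF-complete b)))

plane-isPlane : ∀ {r} (a₁ a₂ a₃ : F₂^ r) → True (isPlane (plane (entry a₁ a₂ a₃)))
plane-isPlane a₁ a₂ a₃ = fromWitness (cong (λ x → false ∷ᵥ false ∷ᵥ x) (entry-sum a₁ a₂ a₃))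

-- From transversals to plane partitions

planes : ∀ {r} → List (Entry r) → List (List (F₂^ (2 + r)))
planes = map plane

_∈-planes?_ : ∀ {r} (B : List (F₂^ (2 + r))) S → Dec (B ∈ planes S)
B ∈-planes? S = DecMembership._∈?_ (List.≡-dec _≟_) B (planes S)

-- Filtering rather than mapping lists the planes of S in the order of sublists (allF (2 + r)),
-- which makes the result one of the candidates counted by N.
partitionOf : ∀ {r} → List (Entry r) → List (List (F₂^ (2 + r)))
partitionOf {r} S = filter (_∈-planes? S) (sublists (allF (2 + r)))

partitionOf∈sublists : ∀ {r} (S : List (Entry r)) → partitionOf S ∈ sublists (sublists (allF (2 + r)))
partitionOf∈sublists {r} S = ∈-sublists⁺ (filter-⊆ (_∈-planes? S) (sublists (allF (2 + r))))

partitionOf-Unique : ∀ {r} (S : List (Entry r)) → Unique (partitionOf S)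
partitionOf-Unique {r} S = Unique.filter⁺ (_∈-planes? S) (sublists-Unique (allF-Unique (2 + r)))

plane∈partitionOf : ∀ {r} {S : List (Entry r)} {e} → e ∈ S → plane e ∈ partitionOf S
plane∈partitionOf {e = e} e∈ = ∈-filter⁺ _ (∈-sublists⁺ (plane⊑allF e)) (∈-map⁺ plane e∈)

∈-partitionOf⁻ : ∀ {r} {S : List (Entry r)} {B} → B ∈ partitionOf S → ∃ λ e → e ∈ S × B ≡ plane e
∈-partitionOf⁻ {r} {S} B∈ with ∈-filter⁻ (_∈-planes? S) {xs = sublists (allF (2 + r))} B∈
... | _ , B∈planes with ∈-map⁻ plane B∈planes
... | e , e∈ , B≡ = e , e∈ , B≡

partitionOf-planes : ∀ {r} {S : List (Entry r)} → S ⊑ entries r →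
                     ∀ {B} → B ∈ partitionOf S → True (isPlane B)
partitionOf-planes S⊑ B∈ with ∈-partitionOf⁻ B∈
... | e , e∈ , refl with ∈-entries⁻ (⊑-lookup S⊑ e∈)
... | a₁ , a₂ , a₃ , refl = plane-isPlane a₁ a₂ a₃

-- The planes through embed j x are those of the entries with j-th coordinate x,
-- and a transversal has exactly one such entry.
partitionOf-covers-once : ∀ {r} (S : List (Entry r)) → True (isTransversal r S) →
                          ∀ v → countᵇ (v ∈ᵇ_) (partitionOf S) ≡ 1
partitionOf-covers-once S t v with split v | embed-split v
... | j , x | refl with ∈-map⁻ (λ e → lookup e j) (isTransversal⇒column-complete S t j x)
... | e₀ , e₀∈ , x≡ = countᵇ≡1 (embed j x ∈ᵇ_) (partitionOf-Unique S) (plane∈partitionOf e₀∈)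
  (Equivalence.from ∈ᵇ⇔∈ (subst (λ y → embed j y ∈ plane e₀) (sym x≡) (embed∈plane⁺ e₀ j)))
  only-e₀
  where
  only-e₀ : ∀ {B} → B ∈ partitionOf S → True (embed j x ∈ᵇ B) → B ≡ plane e₀
  only-e₀ B∈ v∈B with ∈-partitionOf⁻ B∈
  ... | e , e∈ , refl = cong plane
    (Unique-map⇒injective (λ e → lookup e j) (isTransversal⇒column-Unique S t j) e∈ e₀∈
      (trans (embed∈plane⁻ e (Equivalence.to ∈ᵇ⇔∈ v∈B)) x≡))

partitionOf-isPlanePartition : ∀ {r} {S : List (Entry r)} → S ⊑ entries r → True (isTransversal r S) →
                               True (isPlanePartition (2 + r) (partitionOf S))
partitionOf-isPlanePartition {r} {S} S⊑ t = Equivalence.from T-∧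
  ( all⁻ isPlane (All.tabulate (partitionOf-planes S⊑))
  , all⁻ (λ v → countᵇ (v ∈ᵇ_) (partitionOf S) ≡ᵇ 1) {allF (2 + r)}
      (All.tabulate (λ {v} _ → ≡⇒≡ᵇ _ 1 (partitionOf-covers-once S t v))))

partitionOf-injective : ∀ {r} {S S′ : List (Entry r)} → S ⊑ entries r → S′ ⊑ entries r →
                        partitionOf S ≡ partitionOf S′ → S ≡ S′
partitionOf-injective {r} S⊑ S′⊑ eq =
  ⊑-Unique-ext (entries-Unique r) S⊑ S′⊑ (transfer eq) (transfer (sym eq))
  where
  transfer : ∀ {S S′ : List (Entry r)} → partitionOf S ≡ partitionOf S′ → ∀ {e} → e ∈ S → e ∈ S′
  transfer eq e∈ with ∈-partitionOf⁻ (subst (_ ∈_) eq (plane∈partitionOf e∈))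
  ... | e′ , e′∈ , plane-e≡ = subst (_∈ _) (sym (plane-injective plane-e≡)) e′∈

transversals : ∀ r → List (List (Entry r))
transversals r = filterᵇ (isTransversal r) (sublists (entries r))

planePartitions : ∀ m → List (List (List (F₂^ m)))
planePartitions m = filterᵇ (isPlanePartition m) (sublists (sublists (allF m)))

transversals-Unique : ∀ r → Unique (transversals r)
transversals-Unique r = Unique.filter⁺ _ (sublists-Unique (entries-Unique r))

∈-transversals⁻ : ∀ {r} {S : List (Entry r)} → S ∈ transversals r →
                  S ⊑ entries r × True (isTransversal r S)
∈-transversals⁻ {r} S∈ with ∈-filter⁻ _ {xs = sublists (entries r)} S∈
... | S∈sublists , t = ∈-sublists⁻ (entries r) S∈sublists , t

partitionOf∈planePartitions : ∀ {r} {S : List (Entry r)} → S ∈ transversals r →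
                              partitionOf S ∈ planePartitions (2 + r)
partitionOf∈planePartitions {S = S} S∈ with ∈-transversals⁻ S∈
... | S⊑ , t = ∈-filter⁺ _ (partitionOf∈sublists S) (partitionOf-isPlanePartition S⊑ t)

proposition4 : (m : ℕ) → 2 ≤ m → T (m ∸ 2) ≤ N m
proposition4 (suc zero)    (s≤s ())
proposition4 (suc (suc r)) _ =
  injection⇒length≤ partitionOf (transversals r) (planePartitions (2 + r)) (transversals-Unique r)
    partitionOf∈planePartitions
    (λ S∈ S′∈ → partitionOf-injective (proj₁ (∈-transversals⁻ S∈)) (proj₁ (∈-transversals⁻ S′∈)))
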